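{- For $0\le m\le 2^k-2$, $$\tau(k,m)\le\frac{b(k-2,m-1)}{2^{m-1}}.$$
   Context: Let $\mathbf{1}$ be the all-ones vector in $\mathbb{R}^k$ and $\mathcal{Q}^*_k:=\{ -1,+1\}^k\setminus\{ -\mathbf{1},\mathbf{1}\}$. For $Y_{k,m}$ a uniformly random $m$-element subset of $\mathcal{Q}^*_k$, $\tau(k,m):=\Pr[\operatorname{conv}(Y_{k,m})\cap\operatorname{conv}\{ -\mathbf{1},\mathbf{1}\}=\varnothing]$. $b(p,q):=\sum_{i=0}^{p}\binom{q}{i}$. -}

module Defs where

open import Data.Bool using (Bool; true; false; if_then_else_)
open import Data.Nat as ℕ using (ℕ; zero; suc; _∸_)
open import Data.Nat.Combinatorics using (_C_)
open import Data.List using (List; []; _∷_; _++_; map; filter; length; foldr; upTo)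
open import Data.Vec using (Vec; []; _∷_; lookup)
open import Data.Fin using (Fin)
open import Data.Rational as ℚ using (ℚ; 0ℚ; 1ℚ; -_)
open import Data.Product using (Σ; _×_; ∃-syntax)
open import Relation.Binary.PropositionalEquality using (_≡_; _≢_)
open import Relation.Nullary using (¬_)
open import Relation.Nullary.Decidable using (⌊_⌋)
open import Data.Bool.Properties using () renaming (_≟_ to _≟ᵇ_)
open import Data.List.Relation.Unary.AllPairs using (AllPairs)
open import Data.List.Relation.Unary.All using (All)

-- A point of {-1,+1}^k is encoded as a Bool vector (true = +1, false = -1).
Pt : ℕ → Set
Pt k = Vec Bool k

sign : Bool → ℚ
sign true  = 1ℚ
sign false = - 1ℚ

allPts : (k : ℕ) → List (Pt k)
allPts zero    = [] ∷ []
allPts (suc k) = map (true ∷_) (allPts k) ++ map (false ∷_) (allPts k)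

constPt : (k : ℕ) → Bool → Pt k
constPt zero    b = []
constPt (suc k) b = b ∷ constPt k b

InQ* : {k : ℕ} → Pt k → Set
InQ* {k} x = (x ≢ constPt k true) × (x ≢ constPt k false)

PtSet : ℕ → Set
PtSet k = Pt k → Bool

card : {k : ℕ} → PtSet k → ℕ
card {k} S = length (filter (λ x → S x ≟ᵇ true) (allPts k))

IsMSubsetQ* : {k : ℕ} → ℕ → PtSet k → Set
IsMSubsetQ* {k} m S = (∀ x → S x ≡ true → InQ* x) × (card S ≡ m)

sumPts : {k : ℕ} → (Pt k → ℚ) → ℚ
sumPts {k} f = foldr (λ x acc → f x ℚ.+ acc) 0ℚ (allPts k)

-- conv(S) ∩ conv{-1,1} ≠ ∅ : there is a convex combination (weights λ ≥ 0,
-- supported on S, summing to 1) of the points of S equal to t·1 for some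
-- t ∈ [-1,1] (conv{-1,1} = {t·1 : -1 ≤ t ≤ 1}).
ConvMeetsDiag : {k : ℕ} → PtSet k → Set
ConvMeetsDiag {k} S =
  Σ (Pt k → ℚ) λ w →
    (∀ x → 0ℚ ℚ.≤ w x) ×
    (∀ x → S x ≡ false → w x ≡ 0ℚ) ×
    (sumPts w ≡ 1ℚ) ×
    ∃[ t ] ((- 1ℚ ℚ.≤ t) × (t ℚ.≤ 1ℚ) ×
            (∀ (i : Fin k) → sumPts (λ x → w x ℚ.* sign (lookup x i)) ≡ t))

Good : {k : ℕ} → PtSet k → Set
Good S = ¬ ConvMeetsDiag S

Distinct : {k : ℕ} → List (PtSet k) → Set
Distinct {k} = AllPairs (λ S T → ∃[ x ] (S x ≢ T x))

b : ℕ → ℕ → ℕ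
b p q = foldr ℕ._+_ 0 (map (q C_) (upTo (suc p)))

-- 2·b(k-2, m-1), with the convention b(p,-1) = 2^{-1} (i.e. b(p,q) = 2^q
-- when q ≤ p), so that the bound for m = 0 reads τ(k,0) ≤ 1.
-- (For m ≥ 1 the hypothesis m ≤ 2^k-2 forces k ≥ 2, so k ∸ 2 = k-2.)
twoB : ℕ → ℕ → ℕ
twoB k zero    = 1
twoB k (suc m) = 2 ℕ.* b (k ∸ 2) m

-- A good set S ⊆ Q*ₖ contains no antipodal pair (else 0 ∈ conv S), so it is recorded
-- by a sign pattern σ on the 2^(k-1) - 1 antipodal pairs ±(1, y): σ(y) says which of
-- the two points, if any, lies in S.  A point Σ λₓ x of conv S lies on the diagonal
-- iff its first coordinate equals all others; with αᵧ the signed weight of the pair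
-- ±(1, y) this reads Σ αᵧ (1 - yⱼ) = 0 for all j.  So for good S the vectors 1 - y in
-- ℚ^(k-1) have no nonzero dependency whose coefficients carry the signs σ(y).
-- Cover's deletion-contraction argument bounds the number of such patterns with m
-- nonzero signs on M vectors in dimension d by C(M, m) · cover m d, where
-- cover m d = 2 b(d-1, m-1); finally C(M, m) · 2^m ≤ C(2M, m) with M = 2^(k-1) - 1.
module Submission where

open import Algebra.Bundles using (CommutativeSemigroup)
open import Algebra.Structures using (IsCommutativeMonoid)
open import Data.Bool using (Bool; true; false; not; if_then_else_)
open import Data.Empty using (⊥; ⊥-elim)
open import Data.Fin using (Fin; punchIn) renaming (zero to fzero; suc to fsuc)
open import Data.List using (List; []; _∷_; _++_; [_]; foldr; map; filter; length; upTo)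
open import Data.List.Membership.Propositional using (_∈_; lose)
open import Data.List.Relation.Unary.All as All using (All; []; _∷_)
open import Data.List.Relation.Unary.Any as Any using (Any; here; there)
open import Data.List.Relation.Unary.AllPairs as AllPairs using (AllPairs; []; _∷_)
open import Data.Maybe using (Maybe; nothing; just)
open import Data.Nat using (ℕ; zero; suc)
import Data.Nat as ℕ
import Data.Nat.Properties as ℕ
open import Data.Nat.Combinatorics using (_C_)
open import Data.Product using (Σ-syntax; ∃-syntax; _×_; _,_; proj₁; proj₂)
import Data.Rational.Properties as ℚ
open import Data.Sum using (_⊎_; inj₁; inj₂)
open import Data.Vec using ([]; _∷_; lookup)
open import Function using (_∘_)
open import Relation.Binary using (DecidableEquality)
open import Relation.Binary.PropositionalEquality
  using (_≡_; _≢_; refl; sym; trans; cong; cong₂; subst; module ≡-Reasoning)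
open import Relation.Nullary using (¬_; Dec; yes; no; ¬?; does; contradiction)

open import Defs

-- Binomial coefficients and Cover's numbers

module _ where

  open import Data.Nat using (_+_; _*_; _^_; _∸_; _≤_; z≤n; s≤s)
  open import Data.Nat.Properties
  open import Data.Nat.Combinatorics using (nCk+nC[k+1]≡[n+1]C[k+1])
  open import Data.Nat.ListAction using (sum)
  open import Data.Nat.ListAction.Properties using (sum-++)
  open import Data.Nat.Solver using (module +-*-Solver)
  open import Data.List.Properties using (upTo-∷ʳ; map-++)
  open import Algebra.Properties.CommutativeSemigroup +-commutativeSemigroup using (interchange)

  C-pascal : ∀ n k → suc n C suc k ≡ n C k + n C suc k
  C-pascal n k = sym (nCk+nC[k+1]≡[n+1]C[k+1] n k)

  nCk≤[1+n]Ck : ∀ n k → n C k ≤ suc n C k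
  nCk≤[1+n]Ck n zero    = ≤-refl
  nCk≤[1+n]Ck n (suc k) = ≤-trans (m≤n+m (n C suc k) (n C k)) (≤-reflexive (sym (C-pascal n k)))

  2[nCk]+nC[1+k]≤[2+n]C[1+k] : ∀ n k → 2 * (n C k) + n C suc k ≤ suc (suc n) C suc k
  2[nCk]+nC[1+k]≤[2+n]C[1+k] n k = begin
    2 * (n C k) + n C suc k        ≡⟨ cong (λ t → n C k + t + n C suc k) (+-identityʳ (n C k)) ⟩
    n C k + n C k + n C suc k      ≡⟨ +-assoc (n C k) (n C k) (n C suc k) ⟩
    n C k + (n C k + n C suc k)    ≡⟨ cong (n C k +_) (sym (C-pascal n k)) ⟩
    n C k + suc n C suc k          ≤⟨ +-monoˡ-≤ (suc n C suc k) (nCk≤[1+n]Ck n k) ⟩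
    suc n C k + suc n C suc k      ≡⟨ sym (C-pascal (suc n) k) ⟩
    suc (suc n) C suc k            ∎
    where open ≤-Reasoning

  nCk*2^k≤[n+n]Ck : ∀ n k → (n C k) * 2 ^ k ≤ (n + n) C k
  nCk*2^k≤[n+n]Ck n       zero    = ≤-refl
  nCk*2^k≤[n+n]Ck zero    (suc k) = z≤n
  nCk*2^k≤[n+n]Ck (suc n) (suc k) = begin
    (suc n C suc k) * 2 ^ suc k                     ≡⟨ cong (_* 2 ^ suc k) (C-pascal n k) ⟩
    (n C k + n C suc k) * 2 ^ suc k                 ≡⟨ regroup (n C k) (n C suc k) (2 ^ k) ⟩
    2 * ((n C k) * 2 ^ k) + (n C suc k) * 2 ^ suc k ≤⟨ +-mono-≤ (*-monoʳ-≤ 2 (nCk*2^k≤[n+n]Ck n k))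
                                                                (nCk*2^k≤[n+n]Ck n (suc k)) ⟩
    2 * ((n + n) C k) + (n + n) C suc k             ≤⟨ 2[nCk]+nC[1+k]≤[2+n]C[1+k] (n + n) k ⟩
    suc (suc (n + n)) C suc k                       ≡⟨ cong (λ t → suc t C suc k) (sym (+-suc n n)) ⟩
    (suc n + suc n) C suc k                         ∎
    where
    open ≤-Reasoning
    open +-*-Solver
    regroup : ∀ a c p → (a + c) * (2 * p) ≡ 2 * (a * p) + c * (2 * p)
    regroup = solve 3 (λ a c p → (a :+ c) :* (con 2 :* p) := con 2 :* (a :* p) :+ c :* (con 2 :* p)) refl

  b-suc : ∀ p q → b (suc p) q ≡ b p q + q C suc p
  b-suc p q = begin
    sum (map (q C_) (upTo (suc (suc p))))              ≡⟨ cong (λ xs → sum (map (q C_) xs)) (sym (upTo-∷ʳ (suc p))) ⟩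
    sum (map (q C_) (upTo (suc p) ++ [ suc p ]))       ≡⟨ cong sum (map-++ (q C_) (upTo (suc p)) [ suc p ]) ⟩
    sum (map (q C_) (upTo (suc p)) ++ [ q C suc p ])   ≡⟨ sum-++ (map (q C_) (upTo (suc p))) [ q C suc p ] ⟩
    b p q + (q C suc p + 0)                            ≡⟨ cong (b p q +_) (+-identityʳ (q C suc p)) ⟩
    b p q + q C suc p                                  ∎
    where open ≡-Reasoning

  b-pascal : ∀ p q → b (suc p) (suc q) ≡ b p q + b (suc p) q
  b-pascal zero    q = cong suc (cong (_+ 0) (C-pascal q 0))
  b-pascal (suc p) q = begin
    b (suc (suc p)) (suc q)                               ≡⟨ b-suc (suc p) (suc q) ⟩
    b (suc p) (suc q) + suc q C suc (suc p)               ≡⟨ cong₂ _+_ (b-pascal p q) (C-pascal q (suc p)) ⟩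
    (b p q + b (suc p) q) + (q C suc p + q C suc (suc p)) ≡⟨ interchange (b p q) (b (suc p) q) (q C suc p) _ ⟩
    (b p q + q C suc p) + (b (suc p) q + q C suc (suc p)) ≡⟨ sym (cong₂ _+_ (b-suc p q) (b-suc (suc p) q)) ⟩
    b (suc p) q + b (suc (suc p)) q                       ∎
    where open ≡-Reasoning

  b[p,0]≡1 : ∀ p → b p 0 ≡ 1
  b[p,0]≡1 zero    = refl
  b[p,0]≡1 (suc p) = trans (b-suc p 0) (trans (+-identityʳ (b p 0)) (b[p,0]≡1 p))

  -- Cover's numbers: cover m d = 2 Σ_{i<d} C(m-1, i) is the number of regions cut out by
  -- m generic hyperplanes through the origin of ℚ^d (deletion-contraction recursion).
  cover : ℕ → ℕ → ℕ
  cover zero    d       = 1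
  cover (suc m) zero    = 0
  cover (suc m) (suc d) = cover m (suc d) + cover m d

  cover[1+m,1+d]≡2b[d,m] : ∀ m d → cover (suc m) (suc d) ≡ 2 * b d m
  cover[1+m,1+d]≡2b[d,m] zero    d       = cong (2 *_) (sym (b[p,0]≡1 d))
  cover[1+m,1+d]≡2b[d,m] (suc m) zero    = trans (+-identityʳ _) (cover[1+m,1+d]≡2b[d,m] m 0)
  cover[1+m,1+d]≡2b[d,m] (suc m) (suc d) = begin
    cover (suc m) (suc (suc d)) + cover (suc m) (suc d) ≡⟨ cong₂ _+_ (cover[1+m,1+d]≡2b[d,m] m (suc d))
                                                                      (cover[1+m,1+d]≡2b[d,m] m d) ⟩
    2 * b (suc d) m + 2 * b d m                         ≡⟨ sym (*-distribˡ-+ 2 (b (suc d) m) (b d m)) ⟩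
    2 * (b (suc d) m + b d m)                           ≡⟨ cong (2 *_) (+-comm (b (suc d) m) (b d m)) ⟩
    2 * (b d m + b (suc d) m)                           ≡⟨ cong (2 *_) (sym (b-pascal d m)) ⟩
    2 * b (suc d) (suc m)                               ∎
    where open ≡-Reasoning

  twoB≡cover : ∀ k m → m + 2 ≤ 2 ^ suc k → twoB (suc k) m ≡ cover m k
  twoB≡cover k       zero    _     = refl
  twoB≡cover zero    (suc m) m+3≤2 with ≤-trans (s≤s (m≤n+m 2 m)) m+3≤2
  ... | s≤s (s≤s ())
  twoB≡cover (suc k) (suc m) _     = sym (cover[1+m,1+d]≡2b[d,m] m k)

  2^[1+k]∸2≡n+n : ∀ k n → suc n ≡ 2 ^ k → 2 ^ suc k ∸ 2 ≡ n + n
  2^[1+k]∸2≡n+n k n 1+n≡2^k = begin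
    2 * 2 ^ k ∸ 2    ≡⟨ cong (λ t → 2 * t ∸ 2) (sym 1+n≡2^k) ⟩
    2 * suc n ∸ 2    ≡⟨ cong (_∸ 1) (+-suc n (n + 0)) ⟩
    n + (n + 0)      ≡⟨ cong (n +_) (+-identityʳ n) ⟩
    n + n            ∎
    where open ≡-Reasoning

  C*cover-pascal : ∀ n m d →
    (n C suc m) * cover (suc m) (suc d) + ((n C m) * cover m (suc d) + (n C m) * cover m d)
    ≡ (suc n C suc m) * cover (suc m) (suc d)
  C*cover-pascal n m d = begin
    (n C suc m) * (x + y) + ((n C m) * x + (n C m) * y)  ≡⟨ regroup (n C suc m) (n C m) x y ⟩
    (n C m + n C suc m) * (x + y)                        ≡⟨ cong (_* (x + y)) (sym (C-pascal n m)) ⟩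
    (suc n C suc m) * (x + y)                            ∎
    where
    open ≡-Reasoning
    open +-*-Solver
    x = cover m (suc d)
    y = cover m d
    regroup : ∀ a c x y → a * (x + y) + (c * x + c * y) ≡ (c + a) * (x + y)
    regroup = solve 4 (λ a c x y → a :* (x :+ y) :+ (c :* x :+ c :* y) := (c :+ a) :* (x :+ y)) refl

-- The cube {-1,1}^k

module _ where

  open import Data.Nat using (_+_; _^_)
  open import Data.Nat.Properties using (+-identityʳ)
  open import Data.Bool.Properties using (not-involutive)
  import Data.Bool.Properties as Bool
  open import Data.List.Properties using (length-++; length-map)
  open import Data.List.Membership.Propositional.Properties using (∈-map⁺; ∈-++⁺ˡ; ∈-++⁺ʳ)
  import Data.List.Relation.Unary.All.Properties as All
  import Data.List.Relation.Unary.AllPairs.Properties as AllPairs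
  open import Data.Vec using () renaming (map to mapᵥ)
  open import Data.Vec.Properties using (lookup-map; ∷-injectiveʳ; ≡-dec)

  _≟ₚ_ : ∀ {k} → DecidableEquality (Pt k)
  _≟ₚ_ = ≡-dec Bool._≟_

  neg : ∀ {k} → Pt k → Pt k
  neg = mapᵥ not

  neg-involutive : ∀ {k} (x : Pt k) → neg (neg x) ≡ x
  neg-involutive []      = refl
  neg-involutive (b ∷ x) = cong₂ _∷_ (not-involutive b) (neg-involutive x)

  neg-constPt : ∀ k → neg (constPt k true) ≡ constPt k false
  neg-constPt zero    = refl
  neg-constPt (suc k) = cong (false ∷_) (neg-constPt k)

  lookup-neg : ∀ {k} (x : Pt k) i → lookup (neg x) i ≡ not (lookup x i)
  lookup-neg x i = lookup-map i not x

  ∈-allPts : ∀ {k} (x : Pt k) → x ∈ allPts k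
  ∈-allPts []                  = here refl
  ∈-allPts (true ∷ x)          = ∈-++⁺ˡ (∈-map⁺ (true ∷_) (∈-allPts x))
  ∈-allPts {suc k} (false ∷ x) = ∈-++⁺ʳ (map (true ∷_) (allPts k)) (∈-map⁺ (false ∷_) (∈-allPts x))

  allPts-unique : ∀ k → AllPairs _≢_ (allPts k)
  allPts-unique zero    = [] ∷ []
  allPts-unique (suc k) = AllPairs.++⁺ (prefixed true) (prefixed false)
    (All.map⁺ (All.universal (λ _ → All.map⁺ (All.universal (λ _ ()) (allPts k))) (allPts k)))
    where
    prefixed : ∀ b → AllPairs _≢_ (map (b ∷_) (allPts k))
    prefixed b = AllPairs.map⁺ (AllPairs.map (λ x≢y → x≢y ∘ ∷-injectiveʳ) (allPts-unique k))

  length-allPts : ∀ k → length (allPts k) ≡ 2 ^ k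
  length-allPts zero    = refl
  length-allPts (suc k) = begin
    length (map (true ∷_) (allPts k) ++ map (false ∷_) (allPts k))         ≡⟨ length-++ (map (true ∷_) (allPts k)) ⟩
    length (map (true ∷_) (allPts k)) + length (map (false ∷_) (allPts k)) ≡⟨ cong₂ _+_ (half true) (half false) ⟩
    2 ^ k + 2 ^ k                                                          ≡⟨ cong (2 ^ k +_) (sym (+-identityʳ (2 ^ k))) ⟩
    2 ^ suc k                                                              ∎
    where
    open ≡-Reasoning
    half : ∀ b → length (map (b ∷_) (allPts k)) ≡ 2 ^ k
    half b = trans (length-map (b ∷_) (allPts k)) (length-allPts k)

  -- Prefixed by true (that is, +1), these points represent the antipodal pairs of Q*ₖ₊₁.
  nonTop : ∀ k → List (Pt k)
  nonTop zero    = []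
  nonTop (suc k) = map (true ∷_) (nonTop k) ++ map (false ∷_) (allPts k)

  allPts≡top∷nonTop : ∀ k → allPts k ≡ constPt k true ∷ nonTop k
  allPts≡top∷nonTop zero    = refl
  allPts≡top∷nonTop (suc k) = cong (λ xs → map (true ∷_) xs ++ map (false ∷_) (allPts k)) (allPts≡top∷nonTop k)

  top∉nonTop : ∀ k → All (constPt k true ≢_) (nonTop k)
  top∉nonTop k = AllPairs.head (subst (AllPairs _≢_) (allPts≡top∷nonTop k) (allPts-unique k))

  nonTop-unique : ∀ k → AllPairs _≢_ (nonTop k)
  nonTop-unique k = AllPairs.tail (subst (AllPairs _≢_) (allPts≡top∷nonTop k) (allPts-unique k))

  1+length-nonTop≡2^k : ∀ k → suc (length (nonTop k)) ≡ 2 ^ k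
  1+length-nonTop≡2^k k = trans (cong length (sym (allPts≡top∷nonTop k))) (length-allPts k)

allPairs-weaken : ∀ {A : Set} {P : A → Set} {R S : A → A → Set} →
  (∀ {a b} → P a → P b → R a b → S a b) → ∀ {xs} → All P xs → AllPairs R xs → AllPairs S xs
allPairs-weaken w []       []         = []
allPairs-weaken w (p ∷ ps) (rs ∷ rss) = All.zipWith (λ (q , r) → w p q r) (ps , rs) ∷ allPairs-weaken w ps rss

any-zipWith : ∀ {A : Set} {P Q R : A → Set} → (∀ {x} → P x → Q x → R x) →
  ∀ {xs} → All P xs → Any Q xs → Any R xs
any-zipWith f (p ∷ _)  (here q)  = here (f p q)
any-zipWith f (_ ∷ ps) (there q) = there (any-zipWith f ps q)

length-filter-split : ∀ {A : Set} {P : A → Set} (P? : ∀ x → Dec (P x)) xs →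
  length xs ≡ length (filter P? xs) ℕ.+ length (filter (¬? ∘ P?) xs)
length-filter-split P? [] = refl
length-filter-split P? (x ∷ xs) with P? x
... | yes _ = cong suc (length-filter-split P? xs)
... | no _  = trans (cong suc (length-filter-split P? xs)) (sym (ℕ.+-suc _ _))

module ListSum {A : Set} {_∙_ : A → A → A} {ε : A}
               (isCommutativeMonoid : IsCommutativeMonoid _≡_ _∙_ ε) where

  open IsCommutativeMonoid isCommutativeMonoid
    using (identityˡ; identityʳ; assoc; comm; isCommutativeSemigroup)

  commutativeSemigroup : CommutativeSemigroup _ _
  commutativeSemigroup = record { isCommutativeSemigroup = isCommutativeSemigroup }

  open import Algebra.Properties.CommutativeSemigroup commutativeSemigroup using (interchange)

  ∑ : {X : Set} → List X → (X → A) → A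
  ∑ xs g = foldr (λ x s → g x ∙ s) ε xs

  module _ {X : Set} where

    ∑-cong : ∀ {g h : X → A} xs → (∀ x → g x ≡ h x) → ∑ xs g ≡ ∑ xs h
    ∑-cong []       eq = refl
    ∑-cong (x ∷ xs) eq = cong₂ _∙_ (eq x) (∑-cong xs eq)

    ∑-cong-All : ∀ {g h : X → A} xs → All (λ x → g x ≡ h x) xs → ∑ xs g ≡ ∑ xs h
    ∑-cong-All []       []         = refl
    ∑-cong-All (x ∷ xs) (eq ∷ eqs) = cong₂ _∙_ eq (∑-cong-All xs eqs)

    ∑-ε : (xs : List X) → ∑ xs (λ _ → ε) ≡ ε
    ∑-ε []       = refl
    ∑-ε (x ∷ xs) = trans (identityˡ _) (∑-ε xs)

    ∑-++ : ∀ xs ys (g : X → A) → ∑ (xs ++ ys) g ≡ ∑ xs g ∙ ∑ ys g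
    ∑-++ []       ys g = sym (identityˡ _)
    ∑-++ (x ∷ xs) ys g = trans (cong (g x ∙_) (∑-++ xs ys g)) (sym (assoc _ _ _))

    ∑-∙ : ∀ xs (g h : X → A) → ∑ xs (λ x → g x ∙ h x) ≡ ∑ xs g ∙ ∑ xs h
    ∑-∙ []       g h = sym (identityˡ ε)
    ∑-∙ (x ∷ xs) g h = trans (cong ((g x ∙ h x) ∙_) (∑-∙ xs g h)) (interchange _ _ _ _)

  ∑-map : ∀ {X Y : Set} (f : X → Y) xs g → ∑ (map f xs) g ≡ ∑ xs (g ∘ f)
  ∑-map f []       g = refl
  ∑-map f (x ∷ xs) g = cong (g (f x) ∙_) (∑-map f xs g)

  ∑-cube-suc : ∀ k (g : Pt (suc k) → A) →
    ∑ (allPts (suc k)) g ≡ ∑ (allPts k) (λ y → g (true ∷ y)) ∙ ∑ (allPts k) (λ y → g (false ∷ y))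
  ∑-cube-suc k g = trans (∑-++ (map (true ∷_) (allPts k)) _ g)
                         (cong₂ _∙_ (∑-map _ (allPts k) g) (∑-map _ (allPts k) g))

  ∑-cube-neg : ∀ k (g : Pt k → A) → ∑ (allPts k) (g ∘ neg) ≡ ∑ (allPts k) g
  ∑-cube-neg zero    g = refl
  ∑-cube-neg (suc k) g = begin
    ∑ (allPts (suc k)) (g ∘ neg)
      ≡⟨ ∑-cube-suc k (g ∘ neg) ⟩
    ∑ (allPts k) (λ y → g (false ∷ neg y)) ∙ ∑ (allPts k) (λ y → g (true ∷ neg y))
      ≡⟨ cong₂ _∙_ (∑-cube-neg k _) (∑-cube-neg k _) ⟩
    ∑ (allPts k) (λ y → g (false ∷ y)) ∙ ∑ (allPts k) (λ y → g (true ∷ y))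
      ≡⟨ comm _ _ ⟩
    ∑ (allPts k) (λ y → g (true ∷ y)) ∙ ∑ (allPts k) (λ y → g (false ∷ y))
      ≡⟨ sym (∑-cube-suc k g) ⟩
    ∑ (allPts (suc k)) g ∎
    where open ≡-Reasoning

  ∑-cube-antipodal : ∀ k (g : Pt (suc k) → A) →
    ∑ (allPts (suc k)) g ≡ ∑ (allPts k) (λ y → g (true ∷ y)) ∙ ∑ (allPts k) (λ y → g (neg (true ∷ y)))
  ∑-cube-antipodal k g = trans (∑-cube-suc k g) (cong₂ _∙_ refl (sym (∑-cube-neg k (λ y → g (false ∷ y)))))

  ∑-cube-pick : ∀ k (p : Pt k) (g : Pt k → A) → ∑ (allPts k) (λ x → if does (x ≟ₚ p) then g x else ε) ≡ g p
  ∑-cube-pick zero    []          g = identityʳ (g [])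
  ∑-cube-pick (suc k) (true ∷ p)  g =
    trans (∑-cube-suc k _) (trans (cong₂ _∙_ (∑-cube-pick k p _) (∑-ε (allPts k))) (identityʳ _))
  ∑-cube-pick (suc k) (false ∷ p) g =
    trans (∑-cube-suc k _) (trans (cong₂ _∙_ (∑-ε (allPts k)) (∑-cube-pick k p _)) (identityˡ _))

module ℕΣ = ListSum ℕ.+-0-isCommutativeMonoid
module ℚΣ = ListSum ℚ.+-0-isCommutativeMonoid

module _ {X : Set} where

  open import Data.Rational using (_+_; _*_; -_; _-_; _≤_; _<_; 0ℚ)
  open import Data.Rational.Properties
  open ℚΣ using (∑)

  ∑-*ˡ : ∀ (xs : List X) c g → ∑ xs (λ x → c * g x) ≡ c * ∑ xs g
  ∑-*ˡ []       c g = sym (*-zeroʳ c)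
  ∑-*ˡ (x ∷ xs) c g = trans (cong (c * g x +_) (∑-*ˡ xs c g)) (sym (*-distribˡ-+ c (g x) (∑ xs g)))

  ∑-*ʳ : ∀ (xs : List X) g c → ∑ xs (λ x → g x * c) ≡ ∑ xs g * c
  ∑-*ʳ []       g c = sym (*-zeroˡ c)
  ∑-*ʳ (x ∷ xs) g c = trans (cong (g x * c +_) (∑-*ʳ xs g c)) (sym (*-distribʳ-+ c (g x) (∑ xs g)))

  ∑-neg : ∀ (xs : List X) g → ∑ xs (λ x → - g x) ≡ - ∑ xs g
  ∑-neg []       g = refl
  ∑-neg (x ∷ xs) g = trans (cong (- g x +_) (∑-neg xs g)) (sym (neg-distrib-+ (g x) (∑ xs g)))

  ∑-minus : ∀ (xs : List X) g h → ∑ xs (λ x → g x - h x) ≡ ∑ xs g - ∑ xs h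
  ∑-minus xs g h = trans (ℚΣ.∑-∙ xs g (λ x → - h x)) (cong (∑ xs g +_) (∑-neg xs h))

  ∑-mono-≤ : ∀ (xs : List X) {g h} → (∀ x → g x ≤ h x) → ∑ xs g ≤ ∑ xs h
  ∑-mono-≤ []       g≤h = ≤-refl
  ∑-mono-≤ (x ∷ xs) g≤h = +-mono-≤ (g≤h x) (∑-mono-≤ xs g≤h)

  ∑-pos : ∀ (xs : List X) {g} → (∀ x → 0ℚ ≤ g x) → Any (λ x → 0ℚ < g x) xs → 0ℚ < ∑ xs g
  ∑-pos (x ∷ xs) 0≤g (here 0<gx) =
    +-mono-<-≤ 0<gx (≤-trans (≤-reflexive (sym (ℚΣ.∑-ε xs))) (∑-mono-≤ xs 0≤g))
  ∑-pos (x ∷ xs) 0≤g (there any) = +-mono-≤-< (0≤g x) (∑-pos xs 0≤g any)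

-- Signed vector configurations and Cover's bound

module _ where

  open import Data.Rational using (ℚ; 0ℚ; 1ℚ; _+_; _*_; -_; _-_; _≤_; _<_; 1/_; ≢-nonZero; nonNegative; nonPositive)
  open import Data.Rational.Properties renaming (_≟_ to _≟ℚ_)
  open import Data.Rational.Solver using (module +-*-Solver)
  open import Algebra.Properties.Group +-0-group using (x∙y⁻¹≈ε⇒x≈y)
  import Data.Bool.Properties as Bool
  import Data.Maybe.Properties as Maybe
  open import Data.Fin.Properties using (punchIn-punchOut; ¬∀⟶∃¬; all?) renaming (_≟_ to _≟ᶠ_)
  open import Data.List.Properties using (length-++)
  open import Data.List.Relation.Unary.All.Properties using (all-filter; filter⁺; ¬All⇒Any¬; ¬Any⇒All¬; All-swap; ++⁺)
  import Data.List.Relation.Unary.AllPairs.Properties as AllPairs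
  open import Relation.Nullary.Decidable using (dec-true; dec-false)

  open ℚΣ using (∑; ∑-cong-All)

  *-≢0 : ∀ {p q} → p ≢ 0ℚ → q ≢ 0ℚ → p * q ≢ 0ℚ
  *-≢0 {p} {q} p≢0 q≢0 pq≡0 = q≢0 (begin
    q                ≡⟨ sym (*-identityˡ q) ⟩
    1ℚ * q           ≡⟨ cong (_* q) (sym (*-inverseˡ p)) ⟩
    1/ p * p * q     ≡⟨ *-assoc (1/ p) p q ⟩
    1/ p * (p * q)   ≡⟨ cong (1/ p *_) pq≡0 ⟩
    1/ p * 0ℚ        ≡⟨ *-zeroʳ (1/ p) ⟩
    0ℚ               ∎)
    where open ≡-Reasoning
          instance _ = ≢-nonZero p≢0

  0≤p*p : ∀ p → 0ℚ ≤ p * p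
  0≤p*p p with ≤-total 0ℚ p
  ... | inj₁ 0≤p = nonNegative⁻¹ _ {{nonNeg*nonNeg⇒nonNeg p {{nonNegative 0≤p}} p {{nonNegative 0≤p}}}}
  ... | inj₂ p≤0 = nonNegative⁻¹ _ {{nonPos*nonPos⇒nonPos p {{nonPositive p≤0}} p {{nonPositive p≤0}}}}

  Sign : Set
  Sign = Maybe Bool

  _≟ₛ_ : DecidableEquality Sign
  _≟ₛ_ = Maybe.≡-dec Bool._≟_

  ∣_∣ₛ : Sign → ℕ
  ∣ nothing ∣ₛ = 0
  ∣ just _  ∣ₛ = 1

  data Conforms : Sign → ℚ → Set where
    none  : ∀ {a} → a ≡ 0ℚ → Conforms nothing a
    plus  : ∀ {a} → 0ℚ ≤ a → Conforms (just true) a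
    minus : ∀ {a} → a ≤ 0ℚ → Conforms (just false) a

  conforms-0 : ∀ σ → Conforms σ 0ℚ
  conforms-0 nothing      = none refl
  conforms-0 (just true)  = plus ≤-refl
  conforms-0 (just false) = minus ≤-refl

  conforms-*ˡ : ∀ {σ a} s → 0ℚ ≤ s → Conforms σ a → Conforms σ (s * a)
  conforms-*ˡ s 0≤s (none refl) = none (*-zeroʳ s)
  conforms-*ˡ s 0≤s (plus 0≤a)  = plus (nonNegative⁻¹ _ {{nonNeg*nonNeg⇒nonNeg s {{nonNegative 0≤s}} _ {{nonNegative 0≤a}}}})
  conforms-*ˡ s 0≤s (minus a≤0) = minus (nonPositive⁻¹ _ {{nonNeg*nonPos⇒nonPos s {{nonNegative 0≤s}} _ {{nonPositive a≤0}}}})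

  conforms-someSign : ∀ a → Σ[ s ∈ Bool ] Conforms (just s) a
  conforms-someSign a with ≤-total 0ℚ a
  ... | inj₁ 0≤a = true , plus 0≤a
  ... | inj₂ a≤0 = false , minus a≤0

  Vector : ℕ → Set
  Vector d = Fin d → ℚ

  module SignedConfiguration {I : Set} (_≟_ : DecidableEquality I) where

    Pattern : Set
    Pattern = I → Sign

    Conformal : List I → Pattern → (I → ℚ) → Set
    Conformal L σ α = All (λ x → Conforms (σ x) (α x)) L

    -- The reoriented vectors σ(x) f(x), x ∈ L with σ(x) defined, have a nontrivial
    -- nonnegative dependency.
    record Cyclic {d} (f : I → Vector d) (L : List I) (σ : Pattern) : Set where
      constructor cyclic
      field
        weights    : I → ℚ
        conformal  : Conformal L σ weights
        balanced   : ∀ j → ∑ L (λ x → weights x * f x j) ≡ 0ℚ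
        nontrivial : Any (λ x → weights x ≢ 0ℚ) L

    Acyclic : ∀ {d} → (I → Vector d) → List I → Pattern → Set
    Acyclic f L σ = ¬ Cyclic f L σ

    support : List I → Pattern → ℕ
    support L σ = ℕΣ.∑ L (λ x → ∣ σ x ∣ₛ)

    DiffersOn : List I → Pattern → Pattern → Set
    DiffersOn L σ τ = Any (λ x → σ x ≢ τ x) L

    AgreesOn : List I → Pattern → Pattern → Set
    AgreesOn L σ τ = All (λ x → σ x ≡ τ x) L

    agreesOn? : ∀ L σ τ → Dec (AgreesOn L σ τ)
    agreesOn? L σ τ = All.all? (λ x → σ x ≟ₛ τ x) L

    _[_≔_] : (I → ℚ) → I → ℚ → I → ℚ
    (α [ y ≔ a ]) x = if does (x ≟ y) then a else α x

    update-same : ∀ α y a → (α [ y ≔ a ]) y ≡ a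
    update-same α y a rewrite dec-true (y ≟ y) refl = refl

    update-other : ∀ α {y} a {x} → y ≢ x → (α [ y ≔ a ]) x ≡ α x
    update-other α {y} a {x} y≢x rewrite dec-false (x ≟ y) (y≢x ∘ sym) = refl

    cyclic-cons : ∀ {d} {f : I → Vector d} {y L σ α} a → All (y ≢_) L →
      Conforms (σ y) a → Conformal L σ α →
      (∀ j → a * f y j + ∑ L (λ x → α x * f x j) ≡ 0ℚ) →
      a ≢ 0ℚ ⊎ Any (λ x → α x ≢ 0ℚ) L → Cyclic f (y ∷ L) σ
    cyclic-cons {f = f} {y} {L} {σ} {α} a y∉L σa σα sums nonzero =
      cyclic (α [ y ≔ a ]) (head-conforms ∷ tail-conforms) sums′ (nonzero′ nonzero)
      where
      agree : All (λ x → (α [ y ≔ a ]) x ≡ α x) L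
      agree = All.map (update-other α a) y∉L
      head-conforms : Conforms (σ y) ((α [ y ≔ a ]) y)
      head-conforms = subst (Conforms (σ y)) (sym (update-same α y a)) σa
      tail-conforms : Conformal L σ (α [ y ≔ a ])
      tail-conforms = All.zipWith (λ (eq , c) → subst (Conforms _) (sym eq) c) (agree , σα)
      sums′ : ∀ j → ∑ (y ∷ L) (λ x → (α [ y ≔ a ]) x * f x j) ≡ 0ℚ
      sums′ j = trans (cong₂ _+_ (cong (_* f y j) (update-same α y a))
                                 (∑-cong-All L (All.map (cong (_* f _ j)) agree)))
                      (sums j)
      nonzero′ : a ≢ 0ℚ ⊎ Any (λ x → α x ≢ 0ℚ) L → Any (λ x → (α [ y ≔ a ]) x ≢ 0ℚ) (y ∷ L)
      nonzero′ (inj₁ a≢0) = here (a≢0 ∘ trans (sym (update-same α y a)))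
      nonzero′ (inj₂ any) = there (any-zipWith (λ eq ne → ne ∘ trans (sym eq)) agree any)

    cyclic-∷ : ∀ {d} {f : I → Vector d} {y L σ} → All (y ≢_) L → Cyclic f L σ → Cyclic f (y ∷ L) σ
    cyclic-∷ {f = f} {y} {σ = σ} y∉L (cyclic α σα sums nonzero) =
      cyclic-cons 0ℚ y∉L (conforms-0 (σ y)) σα
        (λ j → trans (cong (_+ _) (*-zeroˡ (f y j))) (trans (+-identityˡ _) (sums j))) (inj₂ nonzero)

    acyclic-tail : ∀ {d} {f : I → Vector d} {y L σ} → All (y ≢_) L → Acyclic f (y ∷ L) σ → Acyclic f L σ
    acyclic-tail y∉L acyclic = acyclic ∘ cyclic-∷ y∉L

    cyclic-zeroVector : ∀ {d} {f : I → Vector d} {y L σ s} → All (y ≢_) L →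
      (∀ j → f y j ≡ 0ℚ) → σ y ≡ just s → Cyclic f (y ∷ L) σ
    cyclic-zeroVector {f = f} {y} {L} {σ} {s} y∉L fy≡0 σy≡s =
      cyclic-cons (sign s) y∉L (subst (λ t → Conforms t (sign s)) (sym σy≡s) (sign-conforms s))
        (All.tabulate (λ {x} _ → conforms-0 (σ x)))
        (λ j → trans (cong₂ _+_ (trans (cong (sign s *_) (fy≡0 j)) (*-zeroʳ (sign s)))
                                (trans (ℚΣ.∑-cong L (λ x → *-zeroˡ (f x j))) (ℚΣ.∑-ε L)))
                     (+-identityˡ 0ℚ))
        (inj₁ (sign≢0 s))
      where
      sign-conforms : ∀ s → Conforms (just s) (sign s)
      sign-conforms true  = plus (nonNegative⁻¹ 1ℚ)
      sign-conforms false = minus (nonPositive⁻¹ (- 1ℚ))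
      sign≢0 : ∀ s → sign s ≢ 0ℚ
      sign≢0 true  ()
      sign≢0 false ()

    -- f y i · f x - f x i · f y with coordinate i dropped: f x projected along f y,
    -- scaled by f y i to avoid dividing.
    project : ∀ {d} → (I → Vector (suc d)) → I → Fin (suc d) → I → Vector d
    project f y i x j = f y i * f x (punchIn i j) - f x i * f y (punchIn i j)

    -- A dependency of the projections lifts to one of the f x together with f y
    -- (after scaling by (f y i)², which keeps signs); the coefficient of f y may have
    -- either sign, hence the choice of s.
    cyclic-lift : ∀ {d} {f : I → Vector (suc d)} {y L τ} i → All (y ≢_) L → f y i ≢ 0ℚ →
      Cyclic (project f y i) L τ →
      Σ[ s ∈ Bool ] (∀ σ → σ y ≡ just s → AgreesOn L σ τ → Cyclic f (y ∷ L) σ)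
    cyclic-lift {d} {f} {y} {L} {τ} i y∉L fyi≢0 (cyclic α τα sums nonzero) =
      s , λ σ σy≡s σ≗τ →
        cyclic-cons a y∉L (subst (λ t → Conforms t a) (sym σy≡s) a-conforms)
          (All.zipWith (λ (eq , conf) → subst (λ t → Conforms t _) (sym eq) (conforms-*ˡ c² (0≤p*p c) conf)) (σ≗τ , τα))
          lifted-sums
          (inj₂ (Any.map (*-≢0 (*-≢0 fyi≢0 fyi≢0)) nonzero))
      where
      open +-*-Solver
      c = f y i
      c² = c * c
      v : Vector (suc d)
      v j = ∑ L (λ x → α x * f x j)
      a = - (c * v i)
      s = proj₁ (conforms-someSign a)
      a-conforms = proj₂ (conforms-someSign a)
      projected-sum : ∀ j → ∑ L (λ x → α x * project f y i x j) ≡ c * v (punchIn i j) - v i * f y (punchIn i j)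
      projected-sum j = begin
        ∑ L (λ x → α x * (c * f x (punchIn i j) - f x i * f y (punchIn i j)))
          ≡⟨ ℚΣ.∑-cong L (λ x → solve 5 (λ a c g h z → a :* (c :* g :- h :* z) := c :* (a :* g) :- a :* h :* z)
                                       refl (α x) c (f x (punchIn i j)) (f x i) (f y (punchIn i j))) ⟩
        ∑ L (λ x → c * (α x * f x (punchIn i j)) - α x * f x i * f y (punchIn i j))
          ≡⟨ ∑-minus L (λ x → c * (α x * f x (punchIn i j))) (λ x → α x * f x i * f y (punchIn i j)) ⟩
        ∑ L (λ x → c * (α x * f x (punchIn i j))) - ∑ L (λ x → α x * f x i * f y (punchIn i j))
          ≡⟨ cong₂ _-_ (∑-*ˡ L c (λ x → α x * f x (punchIn i j))) (∑-*ʳ L (λ x → α x * f x i) (f y (punchIn i j))) ⟩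
        c * v (punchIn i j) - v i * f y (punchIn i j)   ∎
        where open ≡-Reasoning
      proportional : ∀ j → c * v j ≡ v i * f y j
      proportional j with j ≟ᶠ i
      ... | yes refl = *-comm c (v i)
      ... | no j≢i = subst (λ t → c * v t ≡ v i * f y t) (punchIn-punchOut i≢j)
                       (x∙y⁻¹≈ε⇒x≈y _ _ (trans (sym (projected-sum _)) (sums _)))
        where i≢j = j≢i ∘ sym
      lifted-sums : ∀ j → a * f y j + ∑ L (λ x → c² * α x * f x j) ≡ 0ℚ
      lifted-sums j = begin
        a * f y j + ∑ L (λ x → c² * α x * f x j)
          ≡⟨ cong (a * f y j +_) (trans (ℚΣ.∑-cong L (λ x → *-assoc c² (α x) (f x j))) (∑-*ˡ L c² _)) ⟩
        a * f y j + c² * v j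
          ≡⟨ cong (a * f y j +_) (trans (*-assoc c c (v j)) (cong (c *_) (proportional j))) ⟩
        a * f y j + c * (v i * f y j)
          ≡⟨ solve 3 (λ c vi z → (:- (c :* vi)) :* z :+ c :* (vi :* z) := con 0ℚ) refl c (v i) (f y j) ⟩
        0ℚ ∎
        where open ≡-Reasoning

    record AcyclicFamily {d} (f : I → Vector d) (L : List I) (m : ℕ) (F : List Pattern) : Set where
      field
        distinct : AllPairs (DiffersOn L) F
        support≡ : All (λ σ → support L σ ≡ m) F
        acyclic  : All (Acyclic f L) F

    open AcyclicFamily

    filter-family : ∀ {d} {f : I → Vector d} {L m F} {P : Pattern → Set} (P? : ∀ σ → Dec (P σ)) →
      AcyclicFamily f L m F → AcyclicFamily f L m (filter P? F)
    filter-family P? fam = record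
      { distinct = AllPairs.filter⁺ P? (distinct fam)
      ; support≡ = filter⁺ P? (support≡ fam)
      ; acyclic  = filter⁺ P? (acyclic fam)
      }

    withSign : I → Sign → List Pattern → List Pattern
    withSign y v = filter (λ σ → σ y ≟ₛ v)

    length-withSign : ∀ y F → length F ≡
      length (withSign y nothing F) ℕ.+ (length (withSign y (just true) F) ℕ.+ length (withSign y (just false) F))
    length-withSign y [] = refl
    length-withSign y (σ ∷ F) with σ y | length-withSign y F
    ... | nothing    | ih = cong suc ih
    ... | just true  | ih = trans (cong suc ih) (sym (ℕ.+-suc _ _))
    ... | just false | ih = trans (cong suc ih) (sym (+-suc-inner (ℓ nothing) (ℓ (just true)) (ℓ (just false))))
      where
      ℓ : Sign → ℕ
      ℓ v = length (withSign y v F)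
      +-suc-inner : ∀ a b c → a ℕ.+ (b ℕ.+ suc c) ≡ suc (a ℕ.+ (b ℕ.+ c))
      +-suc-inner a b c = trans (cong (a ℕ.+_) (ℕ.+-suc b c)) (ℕ.+-suc a (b ℕ.+ c))

    withSign-sign : ∀ y v F → All (λ σ → σ y ≡ v) (withSign y v F)
    withSign-sign y v = all-filter (λ σ → σ y ≟ₛ v)

    restrict-withSign : ∀ {d} {f : I → Vector d} {y L m F} v → All (y ≢_) L →
      AcyclicFamily f (y ∷ L) (∣ v ∣ₛ ℕ.+ m) F → AcyclicFamily f L m (withSign y v F)
    restrict-withSign {y = y} {L} {m} {F} v y∉L fam = record
      { distinct = allPairs-weaken differ-tail (withSign-sign y v F) (distinct fam′)
      ; support≡ = All.zipWith (λ (σy≡v , eq) →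
                     ℕ.+-cancelˡ-≡ ∣ v ∣ₛ _ _ (trans (cong (λ t → ∣ t ∣ₛ ℕ.+ _) (sym σy≡v)) eq))
                     (withSign-sign y v F , support≡ fam′)
      ; acyclic  = All.map (acyclic-tail y∉L) (acyclic fam′)
      }
      where
      fam′ = filter-family (λ σ → σ y ≟ₛ v) fam
      differ-tail : ∀ {σ τ} → σ y ≡ v → τ y ≡ v → DiffersOn (y ∷ L) σ τ → DiffersOn L σ τ
      differ-tail σy≡v τy≡v (here σy≢τy) = ⊥-elim (σy≢τy (trans σy≡v (sym τy≡v)))
      differ-tail σy≡v τy≡v (there differ) = differ

    withSign-members : ∀ {d} {f : I → Vector d} {y L m F} v → AcyclicFamily f (y ∷ L) m F →
      All (λ σ → σ y ≡ v × support (y ∷ L) σ ≡ m × Acyclic f (y ∷ L) σ) (withSign y v F)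
    withSign-members {y = y} {F = F} v fam =
      All.zipWith (λ (σy≡v , supp , acyc) → σy≡v , supp , acyc)
        (withSign-sign y v F , All.zip (support≡ fam′ , acyclic fam′))
      where fam′ = filter-family (λ σ → σ y ≟ₛ v) fam

    length≤C*cover-unsignedAt : ∀ {d} {f : I → Vector d} {y L m F} →
      (∀ {σ s} → σ y ≡ just s → support (y ∷ L) σ ≡ m → Acyclic f (y ∷ L) σ → ⊥) →
      AcyclicFamily f (y ∷ L) m F →
      length (withSign y nothing F) ℕ.≤ (length L C m) ℕ.* cover m d →
      length F ℕ.≤ (suc (length L) C m) ℕ.* cover m d
    length≤C*cover-unsignedAt {d} {y = y} {L} {m} {F} impossible fam unsigned≤ = begin
      length F                                                  ≡⟨ length-withSign y F ⟩
      length (withSign y nothing F) ℕ.+ (length (withSign y (just true) F) ℕ.+ length (withSign y (just false) F))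
                                                                ≡⟨ cong₂ ℕ._+_ refl (cong₂ ℕ._+_ (signed-empty true) (signed-empty false)) ⟩
      length (withSign y nothing F) ℕ.+ 0                       ≡⟨ ℕ.+-identityʳ _ ⟩
      length (withSign y nothing F)                             ≤⟨ unsigned≤ ⟩
      (length L C m) ℕ.* cover m d                              ≤⟨ ℕ.*-monoˡ-≤ (cover m d) (nCk≤[1+n]Ck (length L) m) ⟩
      (suc (length L) C m) ℕ.* cover m d                        ∎
      where
      open ℕ.≤-Reasoning
      signed-empty : ∀ s → length (withSign y (just s) F) ≡ 0
      signed-empty s with withSign y (just s) F | withSign-members (just s) fam
      ... | []    | []                           = refl
      ... | _ ∷ _ | (σy≡s , supp , acyc) ∷ _ = ⊥-elim (impossible σy≡s supp acyc)

    -- Deletion-contraction: F⁺ together with the members of F⁻ that no member of F⁺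
    -- matches off y is a family for the deletion of y; the matched members of F⁻ are
    -- acyclic for the contraction along f y, by cyclic-lift.
    split-opposite-signs : ∀ {d} {f : I → Vector (suc d)} {y L m F⁺ F⁻} i → All (y ≢_) L → f y i ≢ 0ℚ →
      AcyclicFamily f L m F⁺ → AcyclicFamily f L m F⁻ →
      All (λ σ → σ y ≡ just true × Acyclic f (y ∷ L) σ) F⁺ →
      All (λ σ → σ y ≡ just false × Acyclic f (y ∷ L) σ) F⁻ →
      Σ[ G ∈ List Pattern ] Σ[ H ∈ List Pattern ]
        AcyclicFamily f L m G × AcyclicFamily (project f y i) L m H ×
        length F⁺ ℕ.+ length F⁻ ≡ length G ℕ.+ length H
    split-opposite-signs {f = f} {y} {L} {m} {F⁺} {F⁻} i y∉L fyi≢0 fam⁺ fam⁻ members⁺ members⁻ =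
      F⁺ ++ unmatched , matched , famG , famH , lengths
      where
      matched? : ∀ σ → Dec (Any (λ τ → AgreesOn L τ σ) F⁺)
      matched? σ = Any.any? (λ τ → agreesOn? L τ σ) F⁺
      matched   = filter matched? F⁻
      unmatched = filter (¬? ∘ matched?) F⁻
      fam-unmatched = filter-family (¬? ∘ matched?) fam⁻
      fam-matched   = filter-family matched? fam⁻
      differs : All (λ τ → All (DiffersOn L τ) unmatched) F⁺
      differs = All-swap (All.map (λ {σ} ¬match →
                  All.map (λ {τ} → ¬All⇒Any¬ (λ x → τ x ≟ₛ σ x) L) (¬Any⇒All¬ F⁺ ¬match))
                  (all-filter (¬? ∘ matched?) F⁻))
      famG : AcyclicFamily f L m (F⁺ ++ unmatched)
      famG = record
        { distinct = AllPairs.++⁺ (distinct fam⁺) (distinct fam-unmatched) differs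
        ; support≡ = ++⁺ (support≡ fam⁺) (support≡ fam-unmatched)
        ; acyclic  = ++⁺ (acyclic fam⁺) (acyclic fam-unmatched)
        }
      projected-acyclic : ∀ {σ} → σ y ≡ just false × Acyclic f (y ∷ L) σ →
        Any (λ τ → AgreesOn L τ σ) F⁺ → Acyclic (project f y i) L σ
      projected-acyclic {σ} (σy≡- , σ-acyclic) match dependency =
        refute (cyclic-lift {f = f} {τ = σ} i y∉L fyi≢0 dependency)
        where
        refute : Σ[ s ∈ Bool ] (∀ ρ → ρ y ≡ just s → AgreesOn L ρ σ → Cyclic f (y ∷ L) ρ) → ⊥
        refute (false , lift) = σ-acyclic (lift σ σy≡- (All.tabulate (λ _ → refl)))
        refute (true  , lift) with All.lookupAny members⁺ match
        ... | (τy≡+ , τ-acyclic) , τ≗σ = τ-acyclic (lift (Any.lookup match) τy≡+ τ≗σ)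
      famH : AcyclicFamily (project f y i) L m matched
      famH = record
        { distinct = distinct fam-matched
        ; support≡ = support≡ fam-matched
        ; acyclic  = All.zipWith (λ (member , match) → projected-acyclic member match)
                       (filter⁺ matched? members⁻ , all-filter matched? F⁻)
        }
      lengths : length F⁺ ℕ.+ length F⁻ ≡ length (F⁺ ++ unmatched) ℕ.+ length matched
      lengths = begin
        length F⁺ ℕ.+ length F⁻                               ≡⟨ cong (length F⁺ ℕ.+_) (length-filter-split matched? F⁻) ⟩
        length F⁺ ℕ.+ (length matched ℕ.+ length unmatched)   ≡⟨ cong (length F⁺ ℕ.+_) (ℕ.+-comm (length matched) _) ⟩
        length F⁺ ℕ.+ (length unmatched ℕ.+ length matched)   ≡⟨ sym (ℕ.+-assoc (length F⁺) _ _) ⟩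
        length F⁺ ℕ.+ length unmatched ℕ.+ length matched     ≡⟨ cong (ℕ._+ length matched) (sym (length-++ F⁺)) ⟩
        length (F⁺ ++ unmatched) ℕ.+ length matched            ∎
        where open ≡-Reasoning

    length≤C*cover : ∀ {d} (f : I → Vector d) L → AllPairs _≢_ L → ∀ {m F} → AcyclicFamily f L m F →
      length F ℕ.≤ (length L C m) ℕ.* cover m d
    length≤C*cover f [] [] {zero}  {[]}          fam = ℕ.z≤n
    length≤C*cover f [] [] {zero}  {_ ∷ []}      fam = ℕ.≤-refl
    length≤C*cover f [] [] {zero}  {_ ∷ _ ∷ _}   fam with distinct fam
    ... | (() ∷ _) ∷ _
    length≤C*cover f [] [] {suc m} {[]}          fam = ℕ.z≤n
    length≤C*cover f [] [] {suc m} {_ ∷ _}       fam with support≡ fam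
    ... | () ∷ _
    length≤C*cover {zero} f (y ∷ L) (y∉L ∷ L!) fam =
      length≤C*cover-unsignedAt (λ σy≡s _ acyc → acyc (cyclic-zeroVector y∉L (λ ()) σy≡s))
        fam (length≤C*cover f L L! (restrict-withSign nothing y∉L fam))
    length≤C*cover {suc d} f (y ∷ L) (y∉L ∷ L!) {m} {F} fam with all? (λ j → f y j ≟ℚ 0ℚ) | m
    ... | yes fy≡0 | _ =
      length≤C*cover-unsignedAt (λ σy≡s _ acyc → acyc (cyclic-zeroVector y∉L fy≡0 σy≡s))
        fam (length≤C*cover f L L! (restrict-withSign nothing y∉L fam))
    ... | no fy≢0 | zero =
      length≤C*cover-unsignedAt
        (λ {σ} σy≡s supp _ → ℕ.0≢1+n (trans (sym supp) (cong (λ t → ∣ t ∣ₛ ℕ.+ support L σ) σy≡s)))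
        fam (length≤C*cover f L L! (restrict-withSign nothing y∉L fam))
    ... | no fy≢0 | suc m =
      let i , fyi≢0 = ¬∀⟶∃¬ (suc d) (λ j → f y j ≡ 0ℚ) (λ j → f y j ≟ℚ 0ℚ) fy≢0
          G , H , famG , famH , lengths =
            split-opposite-signs i y∉L fyi≢0 (restrict-withSign (just true) y∉L fam) (restrict-withSign (just false) y∉L fam)
              (signed-acyclic true) (signed-acyclic false)
      in begin
      length F                                                  ≡⟨ length-withSign y F ⟩
      length F₀ ℕ.+ (length (withSign y (just true) F) ℕ.+ length (withSign y (just false) F))
                                                                ≡⟨ cong (length F₀ ℕ.+_) lengths ⟩
      length F₀ ℕ.+ (length G ℕ.+ length H)                     ≤⟨ ℕ.+-mono-≤ (length≤C*cover f L L! (restrict-withSign nothing y∉L fam))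
                                                                     (ℕ.+-mono-≤ (length≤C*cover f L L! famG)
                                                                                  (length≤C*cover (project f y i) L L! famH)) ⟩
      (length L C suc m) ℕ.* cover (suc m) (suc d) ℕ.+ ((length L C m) ℕ.* cover m (suc d) ℕ.+ (length L C m) ℕ.* cover m d)
                                                                ≡⟨ C*cover-pascal (length L) m d ⟩
      (suc (length L) C suc m) ℕ.* cover (suc m) (suc d)        ∎
      where
      open ℕ.≤-Reasoning
      F₀ = withSign y nothing F
      signed-acyclic : ∀ s → All (λ σ → σ y ≡ just s × Acyclic f (y ∷ L) σ) (withSign y (just s) F)
      signed-acyclic s = All.map (λ (σy≡s , _ , acyc) → σy≡s , acyc) (withSign-members (just s) fam)

-- Good sets as acyclic sign patterns

module _ where

  open import Data.Rational using (ℚ; 0ℚ; 1ℚ; _+_; _*_; -_; _-_; _≤_; _<_; 1/_; positive; Positive; NonZero)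
  open import Data.Rational.Properties
  open import Data.Rational.Solver using (module +-*-Solver)
  open import Algebra.Properties.Group +-0-group using (⁻¹-involutive)
  open import Data.Bool.Properties using () renaming (_≟_ to _≟ᵇ_)
  import Data.List.Relation.Unary.All.Properties as All
  import Data.List.Relation.Unary.AllPairs.Properties as AllPairs
  open import Relation.Binary using (tri<; tri≈; tri>)
  open ℚΣ using (∑)

  ≤∧≢⇒< : ∀ {p q} → p ≤ q → p ≢ q → p < q
  ≤∧≢⇒< {p} {q} p≤q p≢q with <-cmp p q
  ... | tri< p<q _ _ = p<q
  ... | tri≈ _ p≡q _ = ⊥-elim (p≢q p≡q)
  ... | tri> _ _ q<p = ⊥-elim (<-irrefl refl (<-≤-trans q<p p≤q))

  -p≤p*sign : ∀ {p} b → 0ℚ ≤ p → - p ≤ p * sign b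
  -p≤p*sign {p} true  0≤p = ≤-trans (≤-trans (neg-antimono-≤ 0≤p) 0≤p) (≤-reflexive (sym (*-identityʳ p)))
  -p≤p*sign {p} false 0≤p = ≤-reflexive (trans (cong -_ (sym (*-identityʳ p))) (neg-distribʳ-* p 1ℚ))

  p*sign≤p : ∀ {p} b → 0ℚ ≤ p → p * sign b ≤ p
  p*sign≤p {p} true  0≤p = ≤-reflexive (*-identityʳ p)
  p*sign≤p {p} false 0≤p = ≤-trans (≤-reflexive (trans (sym (neg-distribʳ-* p 1ℚ)) (cong -_ (*-identityʳ p))))
                                   (≤-trans (neg-antimono-≤ 0≤p) 0≤p)

  cone-meets-diagonal : ∀ {k} (S : PtSet (suc k)) (u : Pt (suc k) → ℚ) r →
    (∀ x → 0ℚ ≤ u x) → (∀ x → S x ≡ false → u x ≡ 0ℚ) → 0ℚ < sumPts u →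
    (∀ i → sumPts (λ x → u x * sign (lookup x i)) ≡ r) → ConvMeetsDiag S
  cone-meets-diagonal {k} S u r 0≤u outside 0<s coordinates =
    w , 0≤w , w-outside , w-total , r * c , -1≤t , t≤1 , w-coordinates
    where
    open +-*-Solver
    pts = allPts (suc k)
    s = sumPts u
    instance
      s-positive : Positive s
      s-positive = positive 0<s
      s-nonZero : NonZero s
      s-nonZero = pos⇒nonZero s
    c = 1/ s
    scale-≤ : ∀ {p q} → p ≤ q → p * c ≤ q * c
    scale-≤ = *-monoʳ-≤-nonNeg c {{pos⇒nonNeg c {{1/pos⇒pos s}}}}
    w : Pt (suc k) → ℚ
    w x = u x * c
    0≤w : ∀ x → 0ℚ ≤ w x
    0≤w x = ≤-trans (≤-reflexive (sym (*-zeroˡ c))) (scale-≤ (0≤u x))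
    w-outside : ∀ x → S x ≡ false → w x ≡ 0ℚ
    w-outside x Sx≡false = trans (cong (_* c) (outside x Sx≡false)) (*-zeroˡ c)
    w-total : sumPts w ≡ 1ℚ
    w-total = trans (∑-*ʳ pts u c) (*-inverseʳ s)
    w-coordinates : ∀ i → sumPts (λ x → w x * sign (lookup x i)) ≡ r * c
    w-coordinates i = begin
      ∑ pts (λ x → u x * c * sign (lookup x i))
        ≡⟨ ℚΣ.∑-cong pts (λ x → solve 3 (λ p q t → p :* q :* t := p :* t :* q) refl (u x) c _) ⟩
      ∑ pts (λ x → u x * sign (lookup x i) * c)
        ≡⟨ ∑-*ʳ pts (λ x → u x * sign (lookup x i)) c ⟩
      sumPts (λ x → u x * sign (lookup x i)) * c
        ≡⟨ cong (_* c) (coordinates i) ⟩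
      r * c ∎
      where open ≡-Reasoning
    -s≤r : - s ≤ r
    -s≤r = ≤-trans (≤-reflexive (sym (∑-neg pts u)))
             (≤-trans (∑-mono-≤ pts (λ x → -p≤p*sign (lookup x fzero) (0≤u x))) (≤-reflexive (coordinates fzero)))
    r≤s : r ≤ s
    r≤s = ≤-trans (≤-reflexive (sym (coordinates fzero))) (∑-mono-≤ pts (λ x → p*sign≤p (lookup x fzero) (0≤u x)))
    -1≤t : - 1ℚ ≤ r * c
    -1≤t = ≤-trans (≤-reflexive (trans (cong -_ (sym (*-inverseʳ s))) (neg-distribˡ-* s c))) (scale-≤ -s≤r)
    t≤1 : r * c ≤ 1ℚ
    t≤1 = ≤-trans (scale-≤ r≤s) (≤-reflexive (*-inverseʳ s))

  indicator : ∀ {k} → Pt k → Pt k → ℚ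
  indicator p x = if does (x ≟ₚ p) then 1ℚ else 0ℚ

  indicator-* : ∀ {k} (p x : Pt k) q → indicator p x * q ≡ (if does (x ≟ₚ p) then q else 0ℚ)
  indicator-* p x q with does (x ≟ₚ p)
  ... | true  = *-identityˡ q
  ... | false = *-zeroˡ q

  0≤indicator : ∀ {k} (p x : Pt k) → 0ℚ ≤ indicator p x
  0≤indicator p x with does (x ≟ₚ p)
  ... | true  = nonNegative⁻¹ 1ℚ
  ... | false = ≤-refl

  indicator-outside : ∀ {k} {S : PtSet k} {p} x → S p ≡ true → S x ≡ false → indicator p x ≡ 0ℚ
  indicator-outside {S = S} {p} x Sp Sx with x ≟ₚ p
  ... | yes refl = contradiction (trans (sym Sp) Sx) (λ ())
  ... | no _     = refl

  sign-not : ∀ b → sign (not b) ≡ - sign b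
  sign-not true  = refl
  sign-not false = refl

  sign-neg : ∀ {k} (x : Pt k) i → sign (lookup (neg x) i) ≡ - sign (lookup x i)
  sign-neg x i = trans (cong sign (lookup-neg x i)) (sign-not (lookup x i))

  AntipodalFree : ∀ {k} → PtSet k → Set
  AntipodalFree S = ∀ x → S x ≡ true → S (neg x) ≡ true → ⊥

  good⇒antipodalFree : ∀ {k} {S : PtSet (suc k)} → Good S → AntipodalFree S
  good⇒antipodalFree {k} {S} good x Sx S-x = good (cone-meets-diagonal S u 0ℚ 0≤u outside 0<total coordinates)
    where
    pts = allPts (suc k)
    u : Pt (suc k) → ℚ
    u z = indicator x z + indicator (neg x) z
    0≤u : ∀ z → 0ℚ ≤ u z
    0≤u z = +-mono-≤ (0≤indicator x z) (0≤indicator (neg x) z)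
    outside : ∀ z → S z ≡ false → u z ≡ 0ℚ
    outside z Sz = cong₂ _+_ (indicator-outside z Sx Sz) (indicator-outside z S-x Sz)
    picks : ∀ (g : Pt (suc k) → ℚ) → ∑ pts (λ z → u z * g z) ≡ g x + g (neg x)
    picks g = begin
      ∑ pts (λ z → u z * g z)
        ≡⟨ ℚΣ.∑-cong pts (λ z → trans (*-distribʳ-+ (g z) (indicator x z) _)
                                      (cong₂ _+_ (indicator-* x z (g z)) (indicator-* (neg x) z (g z)))) ⟩
      ∑ pts (λ z → (if does (z ≟ₚ x) then g z else 0ℚ) + (if does (z ≟ₚ neg x) then g z else 0ℚ))
        ≡⟨ ℚΣ.∑-∙ pts (λ z → if does (z ≟ₚ x) then g z else 0ℚ) (λ z → if does (z ≟ₚ neg x) then g z else 0ℚ) ⟩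
      ∑ pts (λ z → if does (z ≟ₚ x) then g z else 0ℚ) + ∑ pts (λ z → if does (z ≟ₚ neg x) then g z else 0ℚ)
        ≡⟨ cong₂ _+_ (ℚΣ.∑-cube-pick (suc k) x g) (ℚΣ.∑-cube-pick (suc k) (neg x) g) ⟩
      g x + g (neg x) ∎
      where open ≡-Reasoning
    0<total : 0ℚ < sumPts u
    0<total = subst (0ℚ <_) (sym (trans (ℚΣ.∑-cong pts (λ z → sym (*-identityʳ (u z)))) (picks (λ _ → 1ℚ))))
                    (positive⁻¹ (1ℚ + 1ℚ))
    coordinates : ∀ i → sumPts (λ z → u z * sign (lookup z i)) ≡ 0ℚ
    coordinates i = trans (picks (λ z → sign (lookup z i)))
                          (trans (cong (sign (lookup x i) +_) (sign-neg x i)) (+-inverseʳ (sign (lookup x i))))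

  signAt : Bool → Bool → Sign
  signAt true  _     = just true
  signAt false true  = just false
  signAt false false = nothing

  signPattern : ∀ {k} → PtSet (suc k) → Pt k → Sign
  signPattern S y = signAt (S (true ∷ y)) (S (neg (true ∷ y)))

  direction : ∀ {k} → Pt k → Vector k
  direction y j = 1ℚ - sign (lookup y j)

  -- A signed weight a on the pair ±(1, y) split into the weights of its two points.
  share : Bool → Sign → ℚ → ℚ
  share true  (just true)  a = a
  share false (just false) a = - a
  share true  (just false) a = 0ℚ
  share false (just true)  a = 0ℚ
  share _     nothing      a = 0ℚ

  share-true-signAt : ∀ c a → share true (signAt false c) a ≡ 0ℚ
  share-true-signAt true  a = refl
  share-true-signAt false a = refl

  share-false-signAt : ∀ b a → share false (signAt b false) a ≡ 0ℚ
  share-false-signAt true  a = refl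
  share-false-signAt false a = refl

  0≤share : ∀ {σ a} s → Conforms σ a → 0ℚ ≤ share s σ a
  0≤share true  (none _)    = ≤-refl
  0≤share false (none _)    = ≤-refl
  0≤share true  (plus 0≤a)  = 0≤a
  0≤share false (plus _)    = ≤-refl
  0≤share true  (minus _)   = ≤-refl
  0≤share false (minus a≤0) = neg-antimono-≤ a≤0

  share-difference : ∀ {σ a} → Conforms σ a → share true σ a - share false σ a ≡ a
  share-difference (none a≡0)        = sym a≡0
  share-difference {a = a} (plus _)  = +-identityʳ a
  share-difference {a = a} (minus _) = trans (+-identityˡ (- (- a))) (⁻¹-involutive a)

  0<share+share : ∀ {σ a} → Conforms σ a → a ≢ 0ℚ → 0ℚ < share true σ a + share false σ a
  0<share+share (none a≡0) a≢0 = ⊥-elim (a≢0 a≡0)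
  0<share+share {a = a} (plus 0≤a) a≢0 =
    subst (0ℚ <_) (sym (+-identityʳ a)) (≤∧≢⇒< 0≤a (a≢0 ∘ sym))
  0<share+share {a = a} (minus a≤0) a≢0 =
    subst (0ℚ <_) (sym (+-identityˡ (- a))) (neg-antimono-< (≤∧≢⇒< a≤0 a≢0))

  -- The signed weights α on the pairs ±(1, y) as weights on the points of the cube.
  lift : ∀ {k} → (Pt k → Sign) → (Pt k → ℚ) → Pt (suc k) → ℚ
  lift σ α (true  ∷ y) = share true  (σ y) (α y)
  lift σ α (false ∷ y) = share false (σ (neg y)) (α (neg y))

  module _ {k} {σ : Pt k → Sign} {α : Pt k → ℚ} (σα : ∀ y → Conforms (σ y) (α y)) where

    open ℚΣ using (∑)

    private
      pts = allPts k
      P N : Pt k → ℚ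
      P y = share true  (σ y) (α y)
      N y = share false (σ y) (α y)

    lift-antipode : ∀ y → lift σ α (neg (true ∷ y)) ≡ N y
    lift-antipode y = cong (λ z → share false (σ z) (α z)) (neg-involutive y)

    0≤lift : ∀ x → 0ℚ ≤ lift σ α x
    0≤lift (true  ∷ y) = 0≤share true  (σα y)
    0≤lift (false ∷ y) = 0≤share false (σα (neg y))

    0<∑lift : Any (λ y → α y ≢ 0ℚ) (allPts k) → 0ℚ < sumPts (lift σ α)
    0<∑lift nontrivial =
      subst (0ℚ <_) (sym ∑lift≡) (∑-pos pts (λ y → +-mono-≤ (0≤share true (σα y)) (0≤share false (σα y)))
                                           (Any.map (λ {y} → 0<share+share (σα y)) nontrivial))
      where
      ∑lift≡ : sumPts (lift σ α) ≡ ∑ pts (λ y → P y + N y)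
      ∑lift≡ = trans (ℚΣ.∑-cube-antipodal k (lift σ α))
                     (trans (cong (∑ pts P +_) (ℚΣ.∑-cong pts lift-antipode)) (sym (ℚΣ.∑-∙ pts P N)))

    ∑lift*odd : ∀ {t : Pt (suc k) → ℚ} → (∀ y → t (neg (true ∷ y)) ≡ - t (true ∷ y)) →
      sumPts (λ x → lift σ α x * t x) ≡ ∑ (allPts k) (λ y → α y * t (true ∷ y))
    ∑lift*odd {t} t-odd = begin
      sumPts (λ x → lift σ α x * t x)
        ≡⟨ ℚΣ.∑-cube-antipodal k (λ x → lift σ α x * t x) ⟩
      ∑ pts (λ y → P y * t (true ∷ y)) + ∑ pts (λ y → lift σ α (neg (true ∷ y)) * t (neg (true ∷ y)))
        ≡⟨ cong (∑ pts (λ y → P y * t (true ∷ y)) +_) (ℚΣ.∑-cong pts (λ y → cong₂ _*_ (lift-antipode y) (t-odd y))) ⟩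
      ∑ pts (λ y → P y * t (true ∷ y)) + ∑ pts (λ y → N y * - t (true ∷ y))
        ≡⟨ sym (ℚΣ.∑-∙ pts (λ y → P y * t (true ∷ y)) (λ y → N y * - t (true ∷ y))) ⟩
      ∑ pts (λ y → P y * t (true ∷ y) + N y * - t (true ∷ y))
        ≡⟨ ℚΣ.∑-cong pts (λ y → trans (solve 3 (λ p n t → p :* t :+ n :* (:- t) := (p :- n) :* t) refl (P y) (N y) (t (true ∷ y)))
                                       (cong (_* t (true ∷ y)) (share-difference (σα y)))) ⟩
      ∑ pts (λ y → α y * t (true ∷ y))  ∎
      where
      open ≡-Reasoning
      open +-*-Solver

  lift-outside : ∀ {k} {S : PtSet (suc k)} α x → S x ≡ false → lift (signPattern S) α x ≡ 0ℚ
  lift-outside {S = S} α (true ∷ y) Sx≡false =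
    trans (cong (λ b → share true (signAt b (S (neg (true ∷ y)))) (α y)) Sx≡false)
          (share-true-signAt (S (neg (true ∷ y))) (α y))
  lift-outside {S = S} α (false ∷ y) Sx≡false =
    trans (cong (λ c → share false (signAt (S (true ∷ neg y)) c) (α (neg y)))
                (trans (cong (λ z → S (false ∷ z)) (neg-involutive y)) Sx≡false))
          (share-false-signAt (S (true ∷ neg y)) (α (neg y)))

  bit : Bool → ℕ
  bit b = if b then 1 else 0

  ∣signAt∣ : ∀ {a b} → (a ≡ true → b ≡ true → ⊥) → ∣ signAt a b ∣ₛ ≡ bit a ℕ.+ bit b
  ∣signAt∣ {true}  {true}  free = ⊥-elim (free refl refl)
  ∣signAt∣ {true}  {false} free = refl
  ∣signAt∣ {false} {true}  free = refl
  ∣signAt∣ {false} {false} free = refl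

  signAt-injective : ∀ {a b c d} → (a ≡ true → b ≡ true → ⊥) → (c ≡ true → d ≡ true → ⊥) →
    signAt a b ≡ signAt c d → a ≡ c × b ≡ d
  signAt-injective {true}  {true}  free _ _ = ⊥-elim (free refl refl)
  signAt-injective {c = true} {true} _ free _ = ⊥-elim (free refl refl)
  signAt-injective {true}  {false} {true}  {false} _ _ _ = refl , refl
  signAt-injective {false} {true}  {false} {true}  _ _ _ = refl , refl
  signAt-injective {false} {false} {false} {false} _ _ _ = refl , refl
  signAt-injective {true}  {false} {false} {true}  _ _ ()
  signAt-injective {true}  {false} {false} {false} _ _ ()
  signAt-injective {false} {true}  {true}  {false} _ _ ()
  signAt-injective {false} {true}  {false} {false} _ _ ()
  signAt-injective {false} {false} {true}  {false} _ _ ()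
  signAt-injective {false} {false} {false} {true}  _ _ ()

  card≡∑ : ∀ {k} (S : PtSet k) → card S ≡ ℕΣ.∑ (allPts k) (bit ∘ S)
  card≡∑ {k} S = go (allPts k)
    where
    go : ∀ xs → length (filter (λ x → S x ≟ᵇ true) xs) ≡ ℕΣ.∑ xs (bit ∘ S)
    go [] = refl
    go (x ∷ xs) with S x
    ... | true  = cong suc (go xs)
    ... | false = go xs

  module _ {k : ℕ} where

    open SignedConfiguration (_≟ₚ_ {k})

    good⇒acyclic : ∀ {S : PtSet (suc k)} → Good S → Acyclic direction (allPts k) (signPattern S)
    good⇒acyclic {S} good (cyclic α conformal balanced nontrivial) =
      good (cone-meets-diagonal S (lift σ α) (∑ pts α) (0≤lift σα) (lift-outside α) (0<∑lift σα nontrivial)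
                                (λ i → trans (∑lift*odd σα (sign-neg-true i)) (on-coordinate i)))
      where
      open +-*-Solver
      σ = signPattern S
      pts = allPts k
      σα : ∀ y → Conforms (σ y) (α y)
      σα y = All.lookup conformal (∈-allPts y)
      sign-neg-true : ∀ i y → sign (lookup (neg (true ∷ y)) i) ≡ - sign (lookup (true ∷ y) i)
      sign-neg-true i y = sign-neg (true ∷ y) i
      on-coordinate : ∀ i → ∑ pts (λ y → α y * sign (lookup (true ∷ y) i)) ≡ ∑ pts α
      on-coordinate fzero    = ℚΣ.∑-cong pts (λ y → *-identityʳ (α y))
      on-coordinate (fsuc j) = begin
        ∑ pts (λ y → α y * sign (lookup y j))
          ≡⟨ ℚΣ.∑-cong pts (λ y → solve 2 (λ a s → a :* s := a :- a :* (con 1ℚ :- s)) refl (α y) (sign (lookup y j))) ⟩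
        ∑ pts (λ y → α y - α y * direction y j)
          ≡⟨ ∑-minus pts α (λ y → α y * direction y j) ⟩
        ∑ pts α - ∑ pts (λ y → α y * direction y j)
          ≡⟨ cong (λ z → ∑ pts α - z) (balanced j) ⟩
        ∑ pts α - 0ℚ
          ≡⟨ +-identityʳ (∑ pts α) ⟩
        ∑ pts α ∎
        where open ≡-Reasoning

    top : Pt k
    top = constPt k true

    signPattern-top : ∀ {S : PtSet (suc k)} → (∀ x → S x ≡ true → InQ* x) → signPattern S top ≡ nothing
    signPattern-top {S} inQ* = cong₂ signAt (excluded true (λ q → proj₁ q refl))
                                            (trans (cong (λ z → S (false ∷ z)) (neg-constPt k)) (excluded false (λ q → proj₂ q refl)))
      where
      excluded : ∀ b → ¬ InQ* (constPt (suc k) b) → S (constPt (suc k) b) ≡ false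
      excluded b notInQ* with S (constPt (suc k) b) in eq
      ... | true  = ⊥-elim (notInQ* (inQ* _ eq))
      ... | false = refl

    support-signPattern : ∀ {S : PtSet (suc k)} → AntipodalFree S → (∀ x → S x ≡ true → InQ* x) →
      support (nonTop k) (signPattern S) ≡ card S
    support-signPattern {S} free inQ* = begin
      support (nonTop k) (signPattern S)
        ≡⟨ cong (λ v → ∣ v ∣ₛ ℕ.+ support (nonTop k) (signPattern S)) (sym (signPattern-top inQ*)) ⟩
      support (top ∷ nonTop k) (signPattern S)
        ≡⟨ cong (λ L → support L (signPattern S)) (sym (allPts≡top∷nonTop k)) ⟩
      ℕΣ.∑ (allPts k) (λ y → ∣ signPattern S y ∣ₛ)
        ≡⟨ ℕΣ.∑-cong (allPts k) (λ y → ∣signAt∣ (free (true ∷ y))) ⟩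
      ℕΣ.∑ (allPts k) (λ y → bit (S (true ∷ y)) ℕ.+ bit (S (neg (true ∷ y))))
        ≡⟨ ℕΣ.∑-∙ (allPts k) (λ y → bit (S (true ∷ y))) (λ y → bit (S (neg (true ∷ y)))) ⟩
      ℕΣ.∑ (allPts k) (λ y → bit (S (true ∷ y))) ℕ.+ ℕΣ.∑ (allPts k) (λ y → bit (S (neg (true ∷ y))))
        ≡⟨ sym (ℕΣ.∑-cube-antipodal k (bit ∘ S)) ⟩
      ℕΣ.∑ (allPts (suc k)) (bit ∘ S)
        ≡⟨ sym (card≡∑ S) ⟩
      card S ∎
      where open ≡-Reasoning

    signPattern-differs : ∀ {S T : PtSet (suc k)} → AntipodalFree S → AntipodalFree T →
      (∃[ x ] S x ≢ T x) → ∃[ y ] signPattern S y ≢ signPattern T y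
    signPattern-differs {S} {T} freeS freeT (true ∷ y , Sx≢Tx) =
      y , Sx≢Tx ∘ proj₁ ∘ signAt-injective (freeS (true ∷ y)) (freeT (true ∷ y))
    signPattern-differs {S} {T} freeS freeT (false ∷ z , Sx≢Tx) =
      neg z , Sx≢Tx ∘ antipode-agrees ∘ proj₂ ∘ signAt-injective (freeS (true ∷ neg z)) (freeT (true ∷ neg z))
      where
      antipode-agrees : S (false ∷ neg (neg z)) ≡ T (false ∷ neg (neg z)) → S (false ∷ z) ≡ T (false ∷ z)
      antipode-agrees = subst (λ w → S (false ∷ w) ≡ T (false ∷ w)) (neg-involutive z)

    good⇒acyclic-nonTop : ∀ {S : PtSet (suc k)} → Good S → Acyclic direction (nonTop k) (signPattern S)
    good⇒acyclic-nonTop {S} good = acyclic-tail (top∉nonTop k)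
      (subst (λ L → Acyclic direction L (signPattern S)) (allPts≡top∷nonTop k) (good⇒acyclic good))

    signPattern-differsOn : ∀ {S T : PtSet (suc k)} → Good S → Good T →
      (∀ x → S x ≡ true → InQ* x) → (∀ x → T x ≡ true → InQ* x) →
      (∃[ x ] S x ≢ T x) → DiffersOn (nonTop k) (signPattern S) (signPattern T)
    signPattern-differsOn {S} {T} goodS goodT inQ*S inQ*T differ =
      drop-top (subst (Any (λ y → signPattern S y ≢ signPattern T y)) (allPts≡top∷nonTop k)
                      (lose (∈-allPts (proj₁ differs)) (proj₂ differs)))
      where
      differs = signPattern-differs (good⇒antipodalFree goodS) (good⇒antipodalFree goodT) differ
      drop-top : DiffersOn (top ∷ nonTop k) (signPattern S) (signPattern T) → DiffersOn (nonTop k) (signPattern S) (signPattern T)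
      drop-top (here top-differs) = ⊥-elim (top-differs (trans (signPattern-top inQ*S) (sym (signPattern-top inQ*T))))
      drop-top (there differs-on-nonTop) = differs-on-nonTop

    signPattern-family : ∀ {m F} → Distinct F → All (IsMSubsetQ* m) F → All Good F →
      AcyclicFamily direction (nonTop k) m (map signPattern F)
    signPattern-family {m} {F} distinct members goods = record
      { distinct = AllPairs.map⁺ (allPairs-weaken (λ (goodS , inQ*S , _) (goodT , inQ*T , _) →
                     signPattern-differsOn goodS goodT inQ*S inQ*T) (All.zip (goods , members)) distinct)
      ; support≡ = All.map⁺ (All.zipWith (λ (good , inQ* , card≡m) →
                     trans (support-signPattern (good⇒antipodalFree good) inQ*) card≡m) (goods , members))
      ; acyclic  = All.map⁺ (All.map good⇒acyclic-nonTop goods)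
      }

module _ where

  open import Data.Nat using (_+_; _*_; _^_; _∸_; _≤_; s≤s)
  open import Data.Nat.Properties using (≤-trans; m≤n+m; *-monoˡ-≤; *-monoʳ-≤; module ≤-Reasoning)
  open import Data.Nat.Solver using (module +-*-Solver)
  open import Data.List.Properties using (length-map)

  proposition1 : (k m : ℕ) → m + 2 ≤ 2 ^ k →
      (F : List (PtSet k)) → Distinct F → All (IsMSubsetQ* m) F → All Good F →
      length F * 2 ^ m ≤ twoB k m * ((2 ^ k ∸ 2) C m)
  proposition1 zero    m m+2≤1 F distinct members goods with ≤-trans (m≤n+m 2 m) m+2≤1
  ... | s≤s ()
  proposition1 (suc k) m m+2≤2^[1+k] F distinct members goods = begin
    length F * 2 ^ m                        ≡⟨ cong (_* 2 ^ m) (sym (length-map signPattern F)) ⟩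
    length (map signPattern F) * 2 ^ m      ≤⟨ *-monoˡ-≤ (2 ^ m) (SignedConfiguration.length≤C*cover _≟ₚ_ direction
                                                 (nonTop k) (nonTop-unique k) (signPattern-family distinct members goods)) ⟩
    (M C m) * cover m k * 2 ^ m             ≡⟨ solve 3 (λ a c p → a :* c :* p := c :* (a :* p)) refl (M C m) (cover m k) (2 ^ m) ⟩
    cover m k * ((M C m) * 2 ^ m)           ≤⟨ *-monoʳ-≤ (cover m k) (nCk*2^k≤[n+n]Ck M m) ⟩
    cover m k * ((M + M) C m)               ≡⟨ cong₂ _*_ (sym (twoB≡cover k m m+2≤2^[1+k]))
                                                       (cong (_C m) (sym (2^[1+k]∸2≡n+n k M (1+length-nonTop≡2^k k)))) ⟩
    twoB (suc k) m * ((2 ^ suc k ∸ 2) C m)  ∎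
    where
    open ≤-Reasoning
    open +-*-Solver
    M = length (nonTop k)
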